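{- Let $P,Q$ be second-order polynomials. If $\mathtt{L}(P)\in\mathcal{O}^2(\mathtt{L}(Q))$, then $P\in\mathcal{O}^2(Q)$.
   Context: $\mathrm{mon}$ denotes the set of strictly monotone functions $\mathbb{N}\to\mathbb{N}$; $p\times q$ denotes pointwise product. Second-order polynomials in a type-1 variable $\mathtt{L}$ and type-0 variable $\mathtt{n}$ are built from positive integers and $\mathtt{n}$ by $+$, $\cdot$ and $\mathtt{L}(\cdot)$; $P(p)(k)$ is the value with $\mathtt{L}:=p\in\mathrm{mon}$, $\mathtt{n}:=k$. $P\in\mathcal{O}^2(Q)$ iff there exist $q\in\mathrm{mon}$, $k\in\mathbb{N}$ with $P(p)(n)\le Q(p\times q)((n+1)^k)$ for all $p\in\mathrm{mon}$, $n\in\mathbb{N}$. -}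

module Defs where

open import Data.Nat using (ℕ; zero; suc; _+_; _*_; _^_; _≤_; _<_)
open import Data.Product using (Σ; _×_; ∃-syntax)

StrictMono : (ℕ → ℕ) → Set
StrictMono p = ∀ m n → m < n → p m < p n

data SOP : Set where
  pos  : ℕ → SOP          -- pos k denotes the positive integer k + 1
  var  : SOP
  _⊕_  : SOP → SOP → SOP
  _⊗_  : SOP → SOP → SOP
  appL : SOP → SOP

eval : SOP → (ℕ → ℕ) → ℕ → ℕ
eval (pos k)  p n = suc k
eval var      p n = n
eval (P ⊕ Q)  p n = eval P p n + eval Q p n
eval (P ⊗ Q)  p n = eval P p n * eval Q p n
eval (appL P) p n = p (eval P p n)

_×ₚ_ : (ℕ → ℕ) → (ℕ → ℕ) → (ℕ → ℕ)
(p ×ₚ q) n = p n * q n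

_∈O²_ : SOP → SOP → Set
P ∈O² Q = Σ (ℕ → ℕ) λ q → StrictMono q × Σ ℕ λ k →
  ∀ (p : ℕ → ℕ) → StrictMono p → ∀ n →
    eval P p n ≤ eval Q (p ×ₚ q) (suc n ^ k)

-- Let q, k witness L(P) ∈ O²(L(Q)). Put h(x) = ∏suc q x = ∏_{y<x} (1 + q(y)), so that for strictly
-- monotone p the function p' = p × h is again strictly monotone and grows fast enough that
-- p'(y) · q(y) < p'(y + 1). The hypothesis at p' gives p'(P(p')(n)) ≤ p'(Y) · q(Y) < p'(Y + 1)
-- with Y = Q(p' × q)((n+1)^k), hence P(p)(n) ≤ P(p')(n) ≤ Y; and p' × q = p × (q × h),
-- so q × h witnesses P ∈ O²(Q).
module Submission where

open import Defs
open import Data.Nat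
open import Data.Nat.Properties
open import Data.Product using (_,_)
open import Data.Sum using (inj₁; inj₂)
open import Relation.Binary.Core using (_Preserves_⟶_)
open import Relation.Binary.PropositionalEquality
open import Relation.Nullary using (yes; no; contradiction)

monotone-by-step : (f : ℕ → ℕ) → (∀ x → f x ≤ f (suc x)) → f Preserves _≤_ ⟶ _≤_
monotone-by-step f step x≤y = go (≤⇒≤′ x≤y)
  where
  go : ∀ {x y} → x ≤′ y → f x ≤ f y
  go ≤′-refl               = ≤-refl
  go (≤′-step {y} x≤′y) = ≤-trans (go x≤′y) (step y)

StrictMono⇒monotone : ∀ {p} → StrictMono p → p Preserves _≤_ ⟶ _≤_
StrictMono⇒monotone {p} p↑ {x} {y} x≤y with m≤n⇒m<n∨m≡n x≤y
... | inj₁ x<y  = <⇒≤ (p↑ x y x<y)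
... | inj₂ refl = ≤-refl

StrictMono-reflects-< : ∀ {p} → StrictMono p → ∀ {x y} → p x < p y → x < y
StrictMono-reflects-< p↑ {x} {y} px<py with x <? y
... | yes x<y = x<y
... | no  x≮y = contradiction (StrictMono⇒monotone p↑ (≮⇒≥ x≮y)) (<⇒≱ px<py)

StrictMono-×ₚ : ∀ {p h} → StrictMono p → h Preserves _≤_ ⟶ _≤_ →
  (∀ x → NonZero (h x)) → StrictMono (p ×ₚ h)
StrictMono-×ₚ {p} {h} p↑ h↑ h≢0 x y x<y = begin-strict
  p x * h x  <⟨ *-monoˡ-< (h x) {{h≢0 x}} (p↑ x y x<y) ⟩
  p y * h x  ≤⟨ *-monoʳ-≤ (p y) (h↑ (<⇒≤ x<y)) ⟩
  p y * h y  ∎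
  where open ≤-Reasoning

eval-cong : ∀ {f g} → (∀ x → f x ≡ g x) → ∀ P n → eval P f n ≡ eval P g n
eval-cong f≗g (pos k)  n = refl
eval-cong f≗g var      n = refl
eval-cong f≗g (P ⊕ Q)  n = cong₂ _+_ (eval-cong f≗g P n) (eval-cong f≗g Q n)
eval-cong f≗g (P ⊗ Q)  n = cong₂ _*_ (eval-cong f≗g P n) (eval-cong f≗g Q n)
eval-cong {f} {g} f≗g (appL P) n = trans (cong f (eval-cong f≗g P n)) (f≗g (eval P g n))

eval-mono : ∀ {f g} → (∀ x → f x ≤ g x) → g Preserves _≤_ ⟶ _≤_ →
  ∀ P n → eval P f n ≤ eval P g n
eval-mono f≤g g↑ (pos k)  n = ≤-refl
eval-mono f≤g g↑ var      n = ≤-refl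
eval-mono f≤g g↑ (P ⊕ Q)  n = +-mono-≤ (eval-mono f≤g g↑ P n) (eval-mono f≤g g↑ Q n)
eval-mono f≤g g↑ (P ⊗ Q)  n = *-mono-≤ (eval-mono f≤g g↑ P n) (eval-mono f≤g g↑ Q n)
eval-mono {f} f≤g g↑ (appL P) n = ≤-trans (f≤g (eval P f n)) (g↑ (eval-mono f≤g g↑ P n))

module _ (q : ℕ → ℕ) where

  ∏suc : ℕ → ℕ
  ∏suc zero    = 1
  ∏suc (suc x) = ∏suc x * suc (q x)

  ∏suc≢0 : ∀ x → NonZero (∏suc x)
  ∏suc≢0 zero    = _
  ∏suc≢0 (suc x) = m*n≢0 (∏suc x) (suc (q x)) {{∏suc≢0 x}}

  ∏suc-mono : ∏suc Preserves _≤_ ⟶ _≤_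
  ∏suc-mono = monotone-by-step ∏suc λ x → m≤m*n (∏suc x) (suc (q x))

  StrictMono-×∏suc : ∀ {p} → StrictMono p → StrictMono (p ×ₚ ∏suc)
  StrictMono-×∏suc p↑ = StrictMono-×ₚ p↑ ∏suc-mono ∏suc≢0

  ×∏suc-absorbs : ∀ {p} → StrictMono p → ∀ x → (p ×ₚ ∏suc) x * q x < (p ×ₚ ∏suc) (suc x)
  ×∏suc-absorbs {p} p↑ x = begin-strict
    p x * ∏suc x * q x          ≡⟨ *-assoc (p x) (∏suc x) (q x) ⟩
    p x * (∏suc x * q x)        <⟨ *-mono-< (p↑ x (suc x) (n<1+n x))
                                     (*-monoʳ-< (∏suc x) {{∏suc≢0 x}} (n<1+n (q x))) ⟩
    p (suc x) * ∏suc (suc x)    ∎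
    where open ≤-Reasoning

  ×∏suc-×-assoc : ∀ p x → ((p ×ₚ ∏suc) ×ₚ q) x ≡ (p ×ₚ (q ×ₚ ∏suc)) x
  ×∏suc-×-assoc p x = begin
    p x * ∏suc x * q x    ≡⟨ *-assoc (p x) (∏suc x) (q x) ⟩
    p x * (∏suc x * q x)  ≡⟨ cong (p x *_) (*-comm (∏suc x) (q x)) ⟩
    p x * (q x * ∏suc x)  ∎
    where open ≡-Reasoning

corollary10 : (P Q : SOP) → appL P ∈O² appL Q → P ∈O² Q
corollary10 P Q (q , q↑ , k , LP≤LQ) = q ×ₚ ∏suc q , StrictMono-×∏suc q q↑ , k , P≤Q
  where
  P≤Q : ∀ p → StrictMono p → ∀ n → eval P p n ≤ eval Q (p ×ₚ (q ×ₚ ∏suc q)) (suc n ^ k)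
  P≤Q p p↑ n = begin
    eval P p n   ≤⟨ eval-mono p≤p′ (StrictMono⇒monotone p′↑) P n ⟩
    eval P p′ n  ≤⟨ <⇒≤pred (StrictMono-reflects-< p′↑ p′[Pp′n]<p′[1+Y]) ⟩
    Y            ≡⟨ eval-cong (×∏suc-×-assoc q p) Q (suc n ^ k) ⟩
    eval Q (p ×ₚ (q ×ₚ ∏suc q)) (suc n ^ k) ∎
    where
    open ≤-Reasoning
    p′ = p ×ₚ ∏suc q
    p′↑ = StrictMono-×∏suc q p↑
    Y = eval Q (p′ ×ₚ q) (suc n ^ k)

    p≤p′ : ∀ x → p x ≤ p′ x
    p≤p′ x = m≤m*n (p x) (∏suc q x) {{∏suc≢0 q x}}

    p′[Pp′n]<p′[1+Y] : p′ (eval P p′ n) < p′ (suc Y)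
    p′[Pp′n]<p′[1+Y] = ≤-<-trans (LP≤LQ p′ p′↑ n) (×∏suc-absorbs q p↑ Y)
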